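{- For all types $\sigma,\tau$ (both term types or both stack types), if $\sigma\le\tau$ then $[\![\sigma]\!]\subseteq[\![\tau]\!]$.
   Context: Pure $\lambda\mu$-calculus: terms $M,N ::= x \mid \lambda x.M \mid MN \mid \mu\alpha.C$, commands $C ::= [\alpha]M$; reduction is the compatible closure of $(\lambda x.M)N\to M[N/x]$ and $(\mu\beta.C)N\to\mu\beta.(C[\beta\Leftarrow N])$, where $C[\beta\Leftarrow N]$ replaces every subcommand $[\beta]P$ by $[\beta](P[\beta\Leftarrow N])N$. $\mathcal{SN}$ is the set of strongly normalising terms. A stack is a finite (possibly empty) sequence $\vec L=L_1{:}\cdots{:}L_k$ of terms, $M\vec L=ML_1\cdots L_k$; $\mathcal{SN}^*$ is the set of finite stacks of terms in $\mathcal{SN}$. Types: with a single constant $\nu$ and a symbol $\omega$ (not itself a type), term types $\delta ::= \nu \mid \omega\to\nu \mid \kappa\to\nu \mid \delta\wedge\delta$ and stack types $\kappa ::= \delta\times\omega \mid \delta\times\kappa \mid \kappa\wedge\kappa$. The preorder $\le$ is the least preorder with: $\sigma\wedge\tau\le\sigma$; $\sigma\wedge\tau\le\tau$; $\nu\le\omega\to\nu$; $\omega\to\nu\le\nu$; $\delta_1\times\delta_2\times\omega\le\delta_1\times\omega$; $(\delta_1\times\omega)\wedge(\delta_2\times\kappa)\le(\delta_1\wedge\delta_2)\times\kappa$; $(\delta_1\times\kappa_1)\wedge(\delta_2\times\kappa_2)\le(\delta_1\wedge\delta_2)\times(\kappa_1\wedge\kappa_2)$; $\delta_1\le\delta_2\Rightarrow\delta_1\times\omega\le\delta_2\times\omega$;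 $\delta_1\le\delta_2,\kappa_1\le\kappa_2\Rightarrow\delta_1\times\kappa_1\le\delta_2\times\kappa_2$; $\sigma\le\tau_1,\sigma\le\tau_2\Rightarrow\sigma\le\tau_1\wedge\tau_2$; $\kappa_2\le\kappa_1\Rightarrow\kappa_1\to\nu\le\kappa_2\to\nu$. Interpretation: $[\![\nu]\!]=[\![\omega\to\nu]\!]=\mathcal{SN}$; $[\![\kappa\to\nu]\!]=\{M\mid \forall\vec L\in[\![\kappa]\!],\ M\vec L\in\mathcal{SN}\}$; $[\![\delta\times\omega]\!]=\{N{:}\vec L\mid N\in[\![\delta]\!],\vec L\in\mathcal{SN}^*\}$; $[\![\delta\times\kappa]\!]=\{N{:}\vec L\mid N\in[\![\delta]\!],\vec L\in[\![\kappa]\!]\}$; $[\![\sigma\wedge\tau]\!]=[\![\sigma]\!]\cap[\![\tau]\!]$. -}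

module Defs where

open import Data.Nat using (ℕ; zero; suc; _≡ᵇ_; _<ᵇ_; _∸_)
open import Data.Bool using (if_then_else_)
open import Data.List using (List; []; _∷_; foldl)
open import Data.List.Relation.Unary.All using (All)
open import Data.Product using () renaming (_×_ to _and_)
import Data.Empty

-- Pure λμ-terms, locally nameless-free de Bruijn representation.
-- Two independent index spaces: term variables (bound by lam) and
-- names / μ-variables (bound by mu).

mutual
  data Term : Set where
    var : ℕ → Term
    lam : Term → Term
    app : Term → Term → Term
    mu  : Cmd → Term

  data Cmd : Set where
    named : ℕ → Term → Cmd

mutual
  shiftT : ℕ → Term → Term
  shiftT c (var i)   = if i <ᵇ c then var i else var (suc i)
  shiftT c (lam M)   = lam (shiftT (suc c) M)
  shiftT c (app M N) = app (shiftT c M) (shiftT c N)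
  shiftT c (mu C)    = mu (shiftTC c C)

  shiftTC : ℕ → Cmd → Cmd
  shiftTC c (named α M) = named α (shiftT c M)

mutual
  shiftN : ℕ → Term → Term
  shiftN c (var i)   = var i
  shiftN c (lam M)   = lam (shiftN c M)
  shiftN c (app M N) = app (shiftN c M) (shiftN c N)
  shiftN c (mu C)    = mu (shiftNC (suc c) C)

  shiftNC : ℕ → Cmd → Cmd
  shiftNC c (named α M) =
    named (if α <ᵇ c then α else suc α) (shiftN c M)

-- Term substitution  M[N/x]  (x = index k; the binder of x is removed)

mutual
  subst : ℕ → Term → Term → Term
  subst k N (var i)   =
    if i ≡ᵇ k then N else (if i <ᵇ k then var i else var (i ∸ 1))
  subst k N (lam M)   = lam (subst (suc k) (shiftT 0 N) M)
  subst k N (app M P) = app (subst k N M) (subst k N P)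
  subst k N (mu C)    = mu (substC k (shiftN 0 N) C)

  substC : ℕ → Term → Cmd → Cmd
  substC k N (named α M) = named α (subst k N M)

-- Structural substitution  C[β ⇐ N]: every subcommand [β]P becomes
-- [β](P[β ⇐ N]) N  (β = name index b; the binder of β is kept)

mutual
  ssub : ℕ → Term → Term → Term
  ssub b N (var i)   = var i
  ssub b N (lam M)   = lam (ssub b (shiftT 0 N) M)
  ssub b N (app M P) = app (ssub b N M) (ssub b N P)
  ssub b N (mu C)    = mu (ssubC (suc b) (shiftN 0 N) C)

  ssubC : ℕ → Term → Cmd → Cmd
  ssubC b N (named α M) =
    if α ≡ᵇ b then named α (app (ssub b N M) N)
              else named α (ssub b N M)

mutual
  data _⟶_ : Term → Term → Set where
    β     : ∀ {M N} → app (lam M) N ⟶ subst 0 N M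
    μ     : ∀ {C N} → app (mu C) N ⟶ mu (ssubC 0 (shiftN 0 N) C)
    ξlam  : ∀ {M M'} → M ⟶ M' → lam M ⟶ lam M'
    ξappₗ : ∀ {M M' N} → M ⟶ M' → app M N ⟶ app M' N
    ξappᵣ : ∀ {M N N'} → N ⟶ N' → app M N ⟶ app M N'
    ξmu   : ∀ {C C'} → C ⟶ᶜ C' → mu C ⟶ mu C'

  data _⟶ᶜ_ : Cmd → Cmd → Set where
    ξnamed : ∀ {α M M'} → M ⟶ M' → named α M ⟶ᶜ named α M'

data SN (M : Term) : Set where
  sn : (∀ {N} → M ⟶ N → SN N) → SN M

Stack : Set
Stack = List Term

_·_ : Term → Stack → Term
M · Ls = foldl app M Ls

SN* : Stack → Set
SN* = All SN

infixr 7 _×ω _⨯_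
infixl 6 _∧ₜ_ _∧ₛ_

mutual
  data TTy : Set where
    ν    : TTy
    ω⇒ν  : TTy
    _⇒ν  : STy → TTy
    _∧ₜ_ : TTy → TTy → TTy

  data STy : Set where
    _×ω  : TTy → STy
    _⨯_  : TTy → STy → STy
    _∧ₛ_ : STy → STy → STy

infix 4 _≤ₜ_ _≤ₛ_

mutual
  data _≤ₜ_ : TTy → TTy → Set where
    reflₜ   : ∀ {σ} → σ ≤ₜ σ
    transₜ  : ∀ {σ τ ρ} → σ ≤ₜ τ → τ ≤ₜ ρ → σ ≤ₜ ρ
    ∧-lₜ    : ∀ {σ τ} → σ ∧ₜ τ ≤ₜ σ
    ∧-rₜ    : ∀ {σ τ} → σ ∧ₜ τ ≤ₜ τ
    ν≤ω⇒ν   : ν ≤ₜ ω⇒ν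
    ω⇒ν≤ν   : ω⇒ν ≤ₜ ν
    ∧-introₜ : ∀ {σ τ₁ τ₂} → σ ≤ₜ τ₁ → σ ≤ₜ τ₂ → σ ≤ₜ τ₁ ∧ₜ τ₂
    ⇒ν-contra : ∀ {κ₁ κ₂} → κ₂ ≤ₛ κ₁ → κ₁ ⇒ν ≤ₜ κ₂ ⇒ν

  data _≤ₛ_ : STy → STy → Set where
    reflₛ   : ∀ {σ} → σ ≤ₛ σ
    transₛ  : ∀ {σ τ ρ} → σ ≤ₛ τ → τ ≤ₛ ρ → σ ≤ₛ ρ
    ∧-lₛ    : ∀ {σ τ} → σ ∧ₛ τ ≤ₛ σ
    ∧-rₛ    : ∀ {σ τ} → σ ∧ₛ τ ≤ₛ τ
    drop    : ∀ {δ₁ δ₂} → δ₁ ⨯ (δ₂ ×ω) ≤ₛ δ₁ ×ω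
    ∧-×ω    : ∀ {δ₁ δ₂ κ} → (δ₁ ×ω) ∧ₛ (δ₂ ⨯ κ) ≤ₛ (δ₁ ∧ₜ δ₂) ⨯ κ
    ∧-×     : ∀ {δ₁ δ₂ κ₁ κ₂} →
              (δ₁ ⨯ κ₁) ∧ₛ (δ₂ ⨯ κ₂) ≤ₛ (δ₁ ∧ₜ δ₂) ⨯ (κ₁ ∧ₛ κ₂)
    mono-×ω : ∀ {δ₁ δ₂} → δ₁ ≤ₜ δ₂ → δ₁ ×ω ≤ₛ δ₂ ×ω
    mono-×  : ∀ {δ₁ δ₂ κ₁ κ₂} → δ₁ ≤ₜ δ₂ → κ₁ ≤ₛ κ₂ → δ₁ ⨯ κ₁ ≤ₛ δ₂ ⨯ κ₂
    ∧-introₛ : ∀ {σ τ₁ τ₂} → σ ≤ₛ τ₁ → σ ≤ₛ τ₂ → σ ≤ₛ τ₁ ∧ₛ τ₂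

mutual
  ⟦_⟧ₜ : TTy → Term → Set
  ⟦ ν ⟧ₜ M        = SN M
  ⟦ ω⇒ν ⟧ₜ M      = SN M
  ⟦ κ ⇒ν ⟧ₜ M     = ∀ (Ls : Stack) → ⟦ κ ⟧ₛ Ls → SN (M · Ls)
  ⟦ σ ∧ₜ τ ⟧ₜ M   = ⟦ σ ⟧ₜ M and ⟦ τ ⟧ₜ M

  ⟦_⟧ₛ : STy → Stack → Set
  ⟦ δ ×ω ⟧ₛ []        = Data.Empty.⊥
  ⟦ δ ×ω ⟧ₛ (N ∷ Ls)  = ⟦ δ ⟧ₜ N and SN* Ls
  ⟦ δ ⨯ κ ⟧ₛ []       = Data.Empty.⊥
  ⟦ δ ⨯ κ ⟧ₛ (N ∷ Ls) = ⟦ δ ⟧ₜ N and ⟦ κ ⟧ₛ Ls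
  ⟦ σ ∧ₛ τ ⟧ₛ Ls      = ⟦ σ ⟧ₛ Ls and ⟦ τ ⟧ₛ Ls

-- Every rule of ≤ except δ₁×δ₂×ω ≤ δ₁×ω is sound by a direct reading of the
-- interpretation (intersection as pairing, contravariance of κ→ν). That rule forgets
-- the type δ₂ of a stack entry, which then only has to be strongly normalising, so it
-- needs ⟦δ⟧ ⊆ SN for every type δ. This follows together with the dual fact that
-- variables inhabit every type: a term of type κ→ν applied to a stack of variables
-- of type κ is SN, hence so is its head; and a variable applied to an SN stack is SN.

module Submission where

open import Defs
open import Data.Product using (_×_; _,_; proj₁; proj₂)
open import Data.Nat using (ℕ; suc; _⊔_; _≤_; s≤s)
open import Data.Nat.Properties using (m⊔n≤o⇒m≤o; m⊔n≤o⇒n≤o; ≤-refl)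
open import Data.List using ([]; _∷_; replicate)
open import Data.List.Relation.Unary.All using ([]; _∷_)
open import Data.List.Relation.Unary.All.Properties using (replicate⁺)
open import Relation.Binary.PropositionalEquality using (_≡_; refl)

·-reduceˡ : ∀ {M N} Ls → M ⟶ N → (M · Ls) ⟶ (N · Ls)
·-reduceˡ []       r = r
·-reduceˡ (L ∷ Ls) r = ·-reduceˡ Ls (ξappₗ r)

SN-head : ∀ M Ls → SN (M · Ls) → SN M
SN-head M Ls s = go s refl
  where
  go : ∀ {X M} → SN X → X ≡ (M · Ls) → SN M
  go (sn h) refl = sn λ r → go (h (·-reduceˡ Ls r)) refl

data Neutral : Term → Set where
  var : ∀ {i} → Neutral (var i)
  app : ∀ {M N} → Neutral M → Neutral (app M N)

Neutral-⟶ : ∀ {M N} → Neutral M → M ⟶ N → Neutral N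
Neutral-⟶ (app n) (ξappₗ r) = app (Neutral-⟶ n r)
Neutral-⟶ (app n) (ξappᵣ r) = app n

mutual
  SN-app-neutral : ∀ {M N} → Neutral M → SN M → SN N → SN (app M N)
  SN-app-neutral n sM sN = sn (SN-app-neutral-⟶ n sM sN)

  SN-app-neutral-⟶ : ∀ {M N X} → Neutral M → SN M → SN N → app M N ⟶ X → SN X
  SN-app-neutral-⟶ n (sn hM) sN      (ξappₗ r) = SN-app-neutral (Neutral-⟶ n r) (hM r) sN
  SN-app-neutral-⟶ n sM      (sn hN) (ξappᵣ r) = SN-app-neutral n sM (hN r)

SN-·-neutral : ∀ {M} Ls → Neutral M → SN M → SN* Ls → SN (M · Ls)
SN-·-neutral []       n s []          = s
SN-·-neutral (L ∷ Ls) n s (sL ∷ sLs) = SN-·-neutral Ls (app n) (SN-app-neutral n s sL) sLs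

SN-var : ∀ i → SN (var i)
SN-var i = sn λ ()

-- Every stack of at least this length, all of whose entries are variables, has type κ.
minLength : STy → ℕ
minLength (δ ×ω)   = 1
minLength (δ ⨯ κ)  = suc (minLength κ)
minLength (κ ∧ₛ κ′) = minLength κ ⊔ minLength κ′

mutual
  var-⟦⟧ₜ : ∀ i δ → ⟦ δ ⟧ₜ (var i)
  var-⟦⟧ₜ i ν        = SN-var i
  var-⟦⟧ₜ i ω⇒ν      = SN-var i
  var-⟦⟧ₜ i (κ ⇒ν) Ls x = SN-·-neutral Ls var (SN-var i) (⟦⟧ₛ⇒SN* κ Ls x)
  var-⟦⟧ₜ i (δ ∧ₜ δ′) = var-⟦⟧ₜ i δ , var-⟦⟧ₜ i δ′

  replicate-var-⟦⟧ₛ : ∀ i κ m → minLength κ ≤ m → ⟦ κ ⟧ₛ (replicate m (var i))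
  replicate-var-⟦⟧ₛ i (δ ×ω)   (suc m) (s≤s _) = var-⟦⟧ₜ i δ , replicate⁺ m (SN-var i)
  replicate-var-⟦⟧ₛ i (δ ⨯ κ)  (suc m) (s≤s p) = var-⟦⟧ₜ i δ , replicate-var-⟦⟧ₛ i κ m p
  replicate-var-⟦⟧ₛ i (κ ∧ₛ κ′) m p =
    replicate-var-⟦⟧ₛ i κ  m (m⊔n≤o⇒m≤o (minLength κ) (minLength κ′) p) ,
    replicate-var-⟦⟧ₛ i κ′ m (m⊔n≤o⇒n≤o (minLength κ) (minLength κ′) p)

  ⟦⟧ₜ⇒SN : ∀ δ M → ⟦ δ ⟧ₜ M → SN M
  ⟦⟧ₜ⇒SN ν        M x = x
  ⟦⟧ₜ⇒SN ω⇒ν      M x = x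
  ⟦⟧ₜ⇒SN (κ ⇒ν)   M x = SN-head M vars (x vars (replicate-var-⟦⟧ₛ 0 κ (minLength κ) ≤-refl))
    where vars = replicate (minLength κ) (var 0)
  ⟦⟧ₜ⇒SN (δ ∧ₜ _) M x = ⟦⟧ₜ⇒SN δ M (proj₁ x)

  ⟦⟧ₛ⇒SN* : ∀ κ Ls → ⟦ κ ⟧ₛ Ls → SN* Ls
  ⟦⟧ₛ⇒SN* (δ ×ω)   (N ∷ Ls) (x , xs) = ⟦⟧ₜ⇒SN δ N x ∷ xs
  ⟦⟧ₛ⇒SN* (δ ⨯ κ)  (N ∷ Ls) (x , xs) = ⟦⟧ₜ⇒SN δ N x ∷ ⟦⟧ₛ⇒SN* κ Ls xs
  ⟦⟧ₛ⇒SN* (κ ∧ₛ _) Ls       x        = ⟦⟧ₛ⇒SN* κ Ls (proj₁ x)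

mutual
  ≤ₜ-sound : ∀ {σ τ : TTy} → σ ≤ₜ τ → ∀ (M : Term) → ⟦ σ ⟧ₜ M → ⟦ τ ⟧ₜ M
  ≤ₜ-sound reflₜ          M x = x
  ≤ₜ-sound (transₜ p q)   M x = ≤ₜ-sound q M (≤ₜ-sound p M x)
  ≤ₜ-sound ∧-lₜ           M x = proj₁ x
  ≤ₜ-sound ∧-rₜ           M x = proj₂ x
  ≤ₜ-sound ν≤ω⇒ν          M x = x
  ≤ₜ-sound ω⇒ν≤ν          M x = x
  ≤ₜ-sound (∧-introₜ p q) M x = ≤ₜ-sound p M x , ≤ₜ-sound q M x
  ≤ₜ-sound (⇒ν-contra p)  M x Ls y = x Ls (≤ₛ-sound p Ls y)

  ≤ₛ-sound : ∀ {σ τ : STy} → σ ≤ₛ τ → ∀ (Ls : Stack) → ⟦ σ ⟧ₛ Ls → ⟦ τ ⟧ₛ Ls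
  ≤ₛ-sound reflₛ          Ls x = x
  ≤ₛ-sound (transₛ p q)   Ls x = ≤ₛ-sound q Ls (≤ₛ-sound p Ls x)
  ≤ₛ-sound ∧-lₛ           Ls x = proj₁ x
  ≤ₛ-sound ∧-rₛ           Ls x = proj₂ x
  ≤ₛ-sound (drop {δ₂ = δ₂}) (N ∷ L ∷ Ls) (x , y , ys) = x , ⟦⟧ₜ⇒SN δ₂ L y ∷ ys
  ≤ₛ-sound ∧-×ω           (N ∷ Ls) ((x , _) , (y , ys))  = (x , y) , ys
  ≤ₛ-sound ∧-×            (N ∷ Ls) ((x , xs) , (y , ys)) = (x , y) , (xs , ys)
  ≤ₛ-sound (mono-×ω p)    (N ∷ Ls) (x , xs) = ≤ₜ-sound p N x , xs
  ≤ₛ-sound (mono-× p q)   (N ∷ Ls) (x , xs) = ≤ₜ-sound p N x , ≤ₛ-sound q Ls xs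
  ≤ₛ-sound (∧-introₛ p q) Ls x = ≤ₛ-sound p Ls x , ≤ₛ-sound q Ls x

lemma2p14 : (∀ {σ τ : TTy} → σ ≤ₜ τ → ∀ (M : Term) → ⟦ σ ⟧ₜ M → ⟦ τ ⟧ₜ M)
            × (∀ {σ τ : STy} → σ ≤ₛ τ → ∀ (Ls : Stack) → ⟦ σ ⟧ₛ Ls → ⟦ τ ⟧ₛ Ls)
lemma2p14 = ≤ₜ-sound , ≤ₛ-sound
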